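{- Let $\mathcal L_R=\{R,\le\}$ with $R,\le$ binary relation symbols, and let $\mathcal X$ be the class of finite topological $\mathcal L_R$-structures $A$ such that $\le^A$ is a total order on $A$ and, for all $a,b\in A$, $aR^Ab$ holds if and only if $a=b$ or $a,b$ are $\le^A$-consecutive. Then $\mathcal X$ is a projective Fraïssé family.
   Context: A finite topological $\mathcal L$-structure is a finite set with the discrete topology endowed with an $\mathcal L$-structure. Two elements $a,b$ of a totally ordered set are consecutive if $a\neq b$ and there is no element strictly between them. An epimorphism between topological $\mathcal L_R$-structures $A,B$ (relational language) is a continuous surjection $\varphi:A\to B$ such that $S^B=(\varphi\times\varphi)(S^A)$ for each binary relation symbol $S\in\mathcal L_R$. A family $\mathcal F$ is a projective Fraïssé family if (JPP) for all $D,E\in\mathcal F$ there are $F\in\mathcal F$ and epimorphisms $F\to D$, $F\to E$, and (AP) for all $C,D,E\in\mathcal F$ and epimorphisms $\varphi_1:D\to C$, $\varphi_2:E\to C$ there are $F\in\mathcal F$ and epimorphisms $\psi_1:F\to D$, $\psi_2:F\to E$ with $\varphi_1\psi_1=\varphi_2\psi_2$. -}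

module Defs where

open import Level using (0ℓ)
open import Data.Nat using (ℕ; suc)
open import Data.Fin using (Fin)
open import Data.Product using (_×_; ∃; ∃-syntax; _,_)
open import Data.Sum using (_⊎_)
open import Relation.Nullary using (¬_)
open import Relation.Binary.PropositionalEquality using (_≡_; _≢_)
open import Relation.Binary.Structures using (IsTotalOrder)
open import Function.Bundles using (_⇔_)

-- A finite (discrete, hence every map is continuous) topological L_R-structure,
-- L_R = {R, ≤}: carrier is a nonempty finite set, represented as Fin (suc size).
record Str : Set₁ where
  field
    size : ℕ
    R    : Fin (suc size) → Fin (suc size) → Set
    Le   : Fin (suc size) → Fin (suc size) → Set

Carrier : Str → Set
Carrier A = Fin (suc (Str.size A))

Lt : (A : Str) → Carrier A → Carrier A → Set
Lt A x y = Str.Le A x y × x ≢ y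

StrictlyBetween : (A : Str) → Carrier A → Carrier A → Carrier A → Set
StrictlyBetween A a b c = (Lt A a c × Lt A c b) ⊎ (Lt A b c × Lt A c a)

Consecutive : (A : Str) → Carrier A → Carrier A → Set
Consecutive A a b = a ≢ b × ¬ (∃[ c ] StrictlyBetween A a b c)

InX : Str → Set
InX A = IsTotalOrder _≡_ (Str.Le A)
      × (∀ a b → Str.R A a b ⇔ (a ≡ b ⊎ Consecutive A a b))

Image : (A B : Str) → (Carrier A → Carrier B)
      → (Carrier A → Carrier A → Set) → Carrier B → Carrier B → Set
Image A B φ S x y = ∃[ a ] ∃[ b ] (φ a ≡ x × φ b ≡ y × S a b)

IsEpi : (A B : Str) → (Carrier A → Carrier B) → Set
IsEpi A B φ = (∀ y → ∃[ x ] φ x ≡ y)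
            × (∀ x y → Str.R B x y ⇔ Image A B φ (Str.R A) x y)
            × (∀ x y → Str.Le B x y ⇔ Image A B φ (Str.Le A) x y)

record Epi (A B : Str) : Set where
  constructor epi
  field
    map   : Carrier A → Carrier B
    isEpi : IsEpi A B map

JPP : (Str → Set) → Set₁
JPP 𝓕 = ∀ D E → 𝓕 D → 𝓕 E →
        ∃[ F ] (𝓕 F × Epi F D × Epi F E)

AP : (Str → Set) → Set₁
AP 𝓕 = ∀ C D E → 𝓕 C → 𝓕 D → 𝓕 E →
       (φ₁ : Epi D C) (φ₂ : Epi E C) →
       ∃[ F ] (𝓕 F × ∃[ ψ₁ ] ∃[ ψ₂ ]
         (∀ (x : Carrier F) →
            Epi.map φ₁ (Epi.map {F} {D} ψ₁ x) ≡ Epi.map φ₂ (Epi.map {F} {E} ψ₂ x)))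

IsProjectiveFraisseFamily : (Str → Set) → Set₁
IsProjectiveFraisseFamily 𝓕 = JPP 𝓕 × AP 𝓕

-- Up to isomorphism the members of X are the paths Path n = {0 < 1 < … < n},
-- R relating equal or adjacent points, and an epimorphism Path m → Path n is the
-- same thing as a *step map*: a function F on positions with F 0 = 0, F m = n,
-- which at each step stays put or goes up by one.  Two step maps Φ₁ : [0,d] → [0,c]
-- and Φ₂ : [0,e] → [0,c] are amalgamated by a lattice walk (i, j) from (0,0) to
-- (d,e) which keeps Φ₁ i = Φ₂ j: at every moment one coordinate can move.  The two
-- coordinates of the walk are again step maps, giving the amalgamating epimorphisms
-- from Path (d + e).

module Submission where

open import Defs
open import Level using (0ℓ)
open import Data.Bool using (if_then_else_)
open import Data.Nat as ℕ using (ℕ; zero; suc; _+_; z≤n; s≤s; _<?_)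
import Data.Nat.Properties as ℕP
open import Data.Fin as Fin using (Fin; toℕ; fromℕ<; fromℕ)
import Data.Fin.Properties as FP
open import Data.Fin.Subset using (Subset; inside; outside; ∣_∣; _∈_; _⊆_)
open import Data.Fin.Subset.Properties using (∈⊤; ⊆⊤; ∣⊤∣≡n; p⊂q⇒∣p∣<∣q∣)
open import Data.Vec using (tabulate; lookup)
open import Data.Vec.Properties using (lookup∘tabulate; []=⇒lookup; lookup⇒[]=)
open import Data.Product using (_×_; ∃-syntax; _,_; proj₁; proj₂; Σ; map₂)
open import Data.Sum as Sum using (_⊎_; inj₁; inj₂)
open import Data.Empty using (⊥-elim)
open import Function using (_∘_)
open import Relation.Nullary using (¬_; yes; no; Dec; does)
open import Relation.Unary using (Pred; Decidable)
open import Relation.Binary.PropositionalEquality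
open import Relation.Binary.Definitions using (tri<; tri≈; tri>)
open import Relation.Binary.Structures using (IsTotalOrder)
open import Function.Bundles using (_⇔_; mk⇔; Equivalence)

Adjacent : ℕ → ℕ → Set
Adjacent i j = suc i ≡ j ⊎ suc j ≡ i

PathR : ∀ {n} → Fin n → Fin n → Set
PathR i j = i ≡ j ⊎ Adjacent (toℕ i) (toℕ j)

PathR-sym : ∀ {n} {i j : Fin n} → PathR i j → PathR j i
PathR-sym = Sum.map sym Sum.swap

Path : ℕ → Str
Path n = record { size = n ; R = PathR ; Le = Fin._≤_ }

<⇒Lt : ∀ {n} {x y : Fin (suc n)} → toℕ x ℕ.< toℕ y → Lt (Path n) x y
<⇒Lt x<y = ℕP.<⇒≤ x<y , λ { refl → ℕP.<-irrefl refl x<y }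

Lt⇒< : ∀ {n} {x y : Fin (suc n)} → Lt (Path n) x y → toℕ x ℕ.< toℕ y
Lt⇒< (x≤y , x≢y) = ℕP.≤∧≢⇒< x≤y (x≢y ∘ FP.toℕ-injective)

adjacent-gapless : ∀ {i j k} → Adjacent i j →
                   ¬ ((i ℕ.< k × k ℕ.< j) ⊎ (j ℕ.< k × k ℕ.< i))
adjacent-gapless (inj₁ refl) (inj₁ (i<k , k<j)) = ℕP.<⇒≱ k<j i<k
adjacent-gapless (inj₁ refl) (inj₂ (j<k , k<i)) = ℕP.<-asym (ℕP.<-trans j<k k<i) (ℕP.n<1+n _)
adjacent-gapless (inj₂ refl) (inj₁ (i<k , k<j)) = ℕP.<-asym (ℕP.<-trans i<k k<j) (ℕP.n<1+n _)
adjacent-gapless (inj₂ refl) (inj₂ (j<k , k<i)) = ℕP.<⇒≱ k<i j<k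

gap-point : ∀ {n} (a b : Fin (suc n)) → toℕ a ℕ.< toℕ b → suc (toℕ a) ≢ toℕ b →
            ∃[ c ] (Lt (Path n) a c × Lt (Path n) c b)
gap-point {n} a b a<b gap = c , <⇒Lt (ℕP.≤-reflexive (sym toℕ-c)) , <⇒Lt (subst (ℕ._< toℕ b) (sym toℕ-c) a+1<b)
  where
  a+1<b : suc (toℕ a) ℕ.< toℕ b
  a+1<b = ℕP.≤∧≢⇒< a<b gap
  a+1≤n : suc (toℕ a) ℕ.< suc n
  a+1≤n = ℕP.<-trans a+1<b (FP.toℕ<n b)
  c : Fin (suc n)
  c = fromℕ< a+1≤n
  toℕ-c : toℕ c ≡ suc (toℕ a)
  toℕ-c = FP.toℕ-fromℕ< a+1≤n

adjacent⇒consecutive : ∀ {n} (a b : Fin (suc n)) → Adjacent (toℕ a) (toℕ b) → Consecutive (Path n) a b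
adjacent⇒consecutive a b adj =
  (λ { refl → Sum.[ ℕP.1+n≢n , ℕP.1+n≢n ] adj })
  , λ { (c , between) → adjacent-gapless adj (Sum.map (λ (p , q) → Lt⇒< p , Lt⇒< q)
                                                      (λ (p , q) → Lt⇒< p , Lt⇒< q) between) }

consecutive⇒adjacent : ∀ {n} (a b : Fin (suc n)) → Consecutive (Path n) a b → Adjacent (toℕ a) (toℕ b)
consecutive⇒adjacent a b (a≢b , nothing-between) with ℕP.<-cmp (toℕ a) (toℕ b)
... | tri≈ _ a≡b _ = ⊥-elim (a≢b (FP.toℕ-injective a≡b))
... | tri< a<b _ _ with suc (toℕ a) ℕ.≟ toℕ b
...   | yes adj = inj₁ adj
...   | no gap  = ⊥-elim (nothing-between (map₂ inj₁ (gap-point a b a<b gap)))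
consecutive⇒adjacent a b (a≢b , nothing-between) | tri> _ _ b<a with suc (toℕ b) ℕ.≟ toℕ a
... | yes adj = inj₂ adj
... | no gap  = ⊥-elim (nothing-between (map₂ inj₂ (gap-point b a b<a gap)))

Path-InX : ∀ n → InX (Path n)
Path-InX n = FP.≤-isTotalOrder , λ a b →
  mk⇔ (Sum.map₂ (adjacent⇒consecutive a b)) (Sum.map₂ (consecutive⇒adjacent a b))

image-∘ : ∀ {A B C : Str} (φ : Carrier A → Carrier B) (ψ : Carrier B → Carrier C)
          {SA : Carrier A → Carrier A → Set} {SB : Carrier B → Carrier B → Set}
          {SC : Carrier C → Carrier C → Set} →
          (∀ x y → SB x y ⇔ Image A B φ SA x y) → (∀ x y → SC x y ⇔ Image B C ψ SB x y) →
          ∀ x y → SC x y ⇔ Image A C (ψ ∘ φ) SA x y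
image-∘ {A} {B} {C} φ ψ {SA} {SB} {SC} hφ hψ x y = mk⇔ down up
  where
  down : SC x y → Image A C (ψ ∘ φ) SA x y
  down s with Equivalence.to (hψ x y) s
  ... | a′ , b′ , refl , refl , sb with Equivalence.to (hφ a′ b′) sb
  ... | a , b , refl , refl , sa = a , b , refl , refl , sa
  up : Image A C (ψ ∘ φ) SA x y → SC x y
  up (a , b , refl , refl , sa) =
    Equivalence.from (hψ x y) (φ a , φ b , refl , refl ,
      Equivalence.from (hφ (φ a) (φ b)) (a , b , refl , refl , sa))

compEpi : ∀ {A B C} → Epi A B → Epi B C → Epi A C
compEpi {A} {B} {C} (epi φ (φ-onto , φ-R , φ-Le)) (epi ψ (ψ-onto , ψ-R , ψ-Le)) =
  epi (ψ ∘ φ) (onto , image-∘ {A} {B} {C} φ ψ φ-R ψ-R , image-∘ {A} {B} {C} φ ψ φ-Le ψ-Le)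
  where
  onto : ∀ z → ∃[ x ] ψ (φ x) ≡ z
  onto z with ψ-onto z
  ... | y , refl with φ-onto y
  ... | x , refl = x , refl

module _ {A B : Str} (φ : Epi A B) where
  open Epi φ

  preserves-R : ∀ {a b} → Str.R A a b → Str.R B (map a) (map b)
  preserves-R r = Equivalence.from (proj₁ (proj₂ isEpi) _ _) (_ , _ , refl , refl , r)

  preserves-Le : ∀ {a b} → Str.Le A a b → Str.Le B (map a) (map b)
  preserves-Le le = Equivalence.from (proj₂ (proj₂ isEpi) _ _) (_ , _ , refl , refl , le)

record OrderIso (A B : Str) : Set where
  field
    to      : Carrier A → Carrier B
    from    : Carrier B → Carrier A
    to-from : ∀ y → to (from y) ≡ y
    from-to : ∀ x → from (to x) ≡ x
    mono    : ∀ {x y} → Str.Le A x y → Str.Le B (to x) (to y)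
    reflect : ∀ {x y} → Str.Le B (to x) (to y) → Str.Le A x y

  to-injective : ∀ {x y} → to x ≡ to y → x ≡ y
  to-injective {x} {y} e = trans (sym (from-to x)) (trans (cong from e) (from-to y))

  retract₂ : (S : Carrier A → Carrier A → Set) → ∀ {x y} → S (from (to x)) (from (to y)) → S x y
  retract₂ S {x} {y} = subst₂ S (from-to x) (from-to y)

open OrderIso

OrderIso-sym : ∀ {A B} → OrderIso A B → OrderIso B A
OrderIso-sym {A} {B} ι = record
  { to      = from ι
  ; from    = to ι
  ; to-from = from-to ι
  ; from-to = to-from ι
  ; mono    = λ {x} {y} le → reflect ι (subst₂ (Str.Le B) (sym (to-from ι x)) (sym (to-from ι y)) le)
  ; reflect = λ {x} {y} le → subst₂ (Str.Le B) (to-from ι x) (to-from ι y) (mono ι le)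
  }

module _ {A B : Str} (ι : OrderIso A B) where

  Lt-to : ∀ {x y} → Lt A x y → Lt B (to ι x) (to ι y)
  Lt-to (x≤y , x≢y) = mono ι x≤y , x≢y ∘ to-injective ι

  between-to : ∀ {a b c} → StrictlyBetween A a b c → StrictlyBetween B (to ι a) (to ι b) (to ι c)
  between-to = Sum.map (λ (p , q) → Lt-to p , Lt-to q) (λ (p , q) → Lt-to p , Lt-to q)

Consecutive-to : ∀ {A B} (ι : OrderIso A B) {a b} → Consecutive A a b → Consecutive B (to ι a) (to ι b)
Consecutive-to {A} ι (a≢b , nothing-between) =
  a≢b ∘ to-injective ι
  , λ { (y , between) → nothing-between
          (from ι y , retract₂ ι (λ a b → StrictlyBetween A a b (from ι y)) (between-to (OrderIso-sym ι) between)) }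

-- In X the relation R is defined from the order, so order isomorphisms preserve it.
R-to : ∀ {A B} → InX A → InX B → (ι : OrderIso A B) → ∀ {a b} → Str.R A a b → Str.R B (to ι a) (to ι b)
R-to xA xB ι r =
  Equivalence.from (proj₂ xB _ _) (Sum.map (cong (to ι)) (Consecutive-to ι) (Equivalence.to (proj₂ xA _ _) r))

R-reflect : ∀ {A B} → InX A → InX B → (ι : OrderIso A B) → ∀ {a b} → Str.R B (to ι a) (to ι b) → Str.R A a b
R-reflect {A} xA xB ι r = retract₂ ι (Str.R A) (R-to xB xA (OrderIso-sym ι) r)

image-along : ∀ {A B} (ι : OrderIso A B)
              (SA : Carrier A → Carrier A → Set) (SB : Carrier B → Carrier B → Set) →
              (∀ {a b} → SA a b → SB (to ι a) (to ι b)) → (∀ {a b} → SB (to ι a) (to ι b) → SA a b) →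
              ∀ x y → SB x y ⇔ Image A B (to ι) SA x y
image-along ι SA SB pres refl′ x y = mk⇔
  (λ s → from ι x , from ι y , to-from ι x , to-from ι y ,
         refl′ (subst₂ SB (sym (to-from ι x)) (sym (to-from ι y)) s))
  (λ { (a , b , refl , refl , s) → pres s })

isoEpi : ∀ {A B} → InX A → InX B → OrderIso A B → Epi A B
isoEpi {A} {B} xA xB ι = epi (to ι)
  ( (λ y → from ι y , to-from ι y)
  , image-along ι (Str.R A) (Str.R B) (R-to xA xB ι) (R-reflect xA xB ι)
  , image-along ι (Str.Le A) (Str.Le B) (mono ι) (reflect ι) )

injective⇒surjective : ∀ {m} (f : Fin m → Fin m) → (∀ {x y} → f x ≡ f y → x ≡ y) → ∀ y → ∃[ x ] f x ≡ y
injective⇒surjective {suc m} f f-injective y with FP.any? (λ x → f x FP.≟ y)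
... | yes hit = hit
... | no miss = ⊥-elim (ℕP.1+n≰n (FP.injective⇒≤ squeeze-injective))
  where
  -- If y were missed, f would squeeze Fin (suc m) injectively into Fin m.
  squeeze : Fin (suc m) → Fin m
  squeeze x = Fin.punchOut {i = y} {j = f x} (λ y≡fx → miss (x , sym y≡fx))
  squeeze-injective : ∀ {x z} → squeeze x ≡ squeeze z → x ≡ z
  squeeze-injective {x} {z} e =
    f-injective (FP.punchOut-injective (λ y≡fx → miss (x , sym y≡fx)) (λ y≡fz → miss (z , sym y≡fz)) e)

subsetOf : ∀ {n} {P : Pred (Fin n) 0ℓ} → Decidable P → Subset n
subsetOf P? = tabulate (λ x → if does (P? x) then inside else outside)

∈-subsetOf : ∀ {n} {P : Pred (Fin n) 0ℓ} (P? : Decidable P) {x : Fin n} → x ∈ subsetOf P? ⇔ P x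
∈-subsetOf {P = P} P? {x} = mk⇔ member⇒P P⇒member
  where
  entry : lookup (subsetOf P?) x ≡ (if does (P? x) then inside else outside)
  entry = lookup∘tabulate _ x
  member⇒P : x ∈ subsetOf P? → P x
  member⇒P x∈ with P? x | trans (sym ([]=⇒lookup x∈)) entry
  ... | yes p | _ = p
  ... | no _  | ()
  P⇒member : P x → x ∈ subsetOf P?
  P⇒member p with P? x | entry
  ... | yes _ | e = lookup⇒[]= x _ e
  ... | no ¬p | _ = ⊥-elim (¬p p)

-- The rank of a is the number of elements below it; it is an order isomorphism onto a path.
module Ranking {A : Str} (xA : InX A) where
  open IsTotalOrder (proj₁ xA) using (total; antisym) renaming (trans to Le-trans)

  n : ℕ
  n = Str.size A

  Lt? : ∀ a b → Dec (Lt A a b)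
  Lt? a b with a FP.≟ b
  ... | yes a≡b = no λ (_ , a≢b) → a≢b a≡b
  ... | no a≢b with total a b
  ...   | inj₁ a≤b = yes (a≤b , a≢b)
  ...   | inj₂ b≤a = no λ (a≤b , _) → a≢b (antisym a≤b b≤a)

  Lt-trans : ∀ {a b c} → Lt A a b → Lt A b c → Lt A a c
  Lt-trans (a≤b , a≢b) (b≤c , _) = Le-trans a≤b b≤c , λ { refl → a≢b (antisym a≤b b≤c) }

  below : Carrier A → Subset (suc n)
  below a = subsetOf (λ b → Lt? b a)

  ∈-below : ∀ a {c} → c ∈ below a ⇔ Lt A c a
  ∈-below a = ∈-subsetOf (λ c → Lt? c a)

  rank : Carrier A → ℕ
  rank a = ∣ below a ∣

  not-below-self : ∀ a → ¬ (a ∈ below a)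
  not-below-self a a∈ = proj₂ (Equivalence.to (∈-below a) a∈) refl

  -- a itself is not below a, so fewer than suc n elements are.
  rank-bounded : ∀ a → rank a ℕ.< suc n
  rank-bounded a = subst (rank a ℕ.<_) (∣⊤∣≡n (suc n))
                     (p⊂q⇒∣p∣<∣q∣ (⊆⊤ , a , ∈⊤ , not-below-self a))

  -- If a < b then everything below a is below b, and so is a itself.
  rank-strict : ∀ {a b} → Lt A a b → rank a ℕ.< rank b
  rank-strict {a} {b} a<b = p⊂q⇒∣p∣<∣q∣ (below-⊆ , a , Equivalence.from (∈-below b) a<b , not-below-self a)
    where
    below-⊆ : below a ⊆ below b
    below-⊆ c∈ = Equivalence.from (∈-below b) (Lt-trans (Equivalence.to (∈-below a) c∈) a<b)

  position : Carrier A → Fin (suc n)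
  position a = fromℕ< (rank-bounded a)

  position-strict : ∀ {a b} → Lt A a b → toℕ (position a) ℕ.< toℕ (position b)
  position-strict {a} {b} a<b =
    subst₂ ℕ._<_ (sym (FP.toℕ-fromℕ< (rank-bounded a))) (sym (FP.toℕ-fromℕ< (rank-bounded b))) (rank-strict a<b)

  position-mono : ∀ {a b} → Str.Le A a b → position a Fin.≤ position b
  position-mono {a} {b} a≤b with a FP.≟ b
  ... | yes refl = ℕP.≤-refl
  ... | no a≢b = ℕP.<⇒≤ (position-strict (a≤b , a≢b))

  position-reflect : ∀ {a b} → position a Fin.≤ position b → Str.Le A a b
  position-reflect {a} {b} pa≤pb with total a b
  ... | inj₁ a≤b = a≤b
  ... | inj₂ b≤a with a FP.≟ b
  ...   | yes refl = b≤a
  ...   | no a≢b = ⊥-elim (ℕP.<⇒≱ (position-strict (b≤a , a≢b ∘ sym)) pa≤pb)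

  position-injective : ∀ {a b} → position a ≡ position b → a ≡ b
  position-injective pa≡pb =
    antisym (position-reflect (ℕP.≤-reflexive (cong toℕ pa≡pb)))
            (position-reflect (ℕP.≤-reflexive (cong toℕ (sym pa≡pb))))

  position-onto : ∀ y → ∃[ a ] position a ≡ y
  position-onto = injective⇒surjective position position-injective

  toPath : OrderIso A (Path n)
  toPath = record
    { to      = position
    ; from    = proj₁ ∘ position-onto
    ; to-from = proj₂ ∘ position-onto
    ; from-to = λ a → position-injective (proj₂ (position-onto (position a)))
    ; mono    = position-mono
    ; reflect = position-reflect
    }

module _ {A : Str} (xA : InX A) where

  toPath-epi : Epi A (Path (Str.size A))
  toPath-epi = isoEpi xA (Path-InX _) (Ranking.toPath xA)

  fromPath-epi : Epi (Path (Str.size A)) A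
  fromPath-epi = isoEpi (Path-InX _) xA (OrderIso-sym (Ranking.toPath xA))

Advance : ℕ → ℕ → Set
Advance a b = b ≡ a ⊎ b ≡ suc a

record IsStepMap (m n : ℕ) (F : ℕ → ℕ) : Set where
  field
    start : F 0 ≡ 0
    end   : F m ≡ n
    step  : ∀ k → k ℕ.< m → Advance (F k) (F (suc k))

module StepMap {m n : ℕ} {F : ℕ → ℕ} (s : IsStepMap m n F) where
  open IsStepMap s public

  step-≤ : ∀ {k} → k ℕ.< m → F k ℕ.≤ F (suc k)
  step-≤ {k} k<m with step k k<m
  ... | inj₁ stay = ℕP.≤-reflexive (sym stay)
  ... | inj₂ up   = ℕP.≤-trans (ℕP.n≤1+n (F k)) (ℕP.≤-reflexive (sym up))

  monotone : ∀ {k l} → k ℕ.≤ l → l ℕ.≤ m → F k ℕ.≤ F l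
  monotone {l = zero} z≤n _ = ℕP.≤-refl
  monotone {l = suc l} k≤l+1 l<m with ℕP.m≤n⇒m<n∨m≡n k≤l+1
  ... | inj₂ refl        = ℕP.≤-refl
  ... | inj₁ (s≤s k≤l)  = ℕP.≤-trans (monotone k≤l (ℕP.<⇒≤ l<m)) (step-≤ l<m)

  bounded : ∀ {k} → k ℕ.≤ m → F k ℕ.≤ n
  bounded {k} k≤m = subst (F k ℕ.≤_) end (monotone k≤m ℕP.≤-refl)

  top-stays : ∀ {k} → k ℕ.< m → F k ≡ n → F (suc k) ≡ F k
  top-stays {k} k<m top with step k k<m
  ... | inj₁ stay = stay
  ... | inj₂ up   = ⊥-elim (ℕP.1+n≰n (subst (ℕ._≤ n) (trans up (cong suc top)) (bounded k<m)))

  crossing : ∀ {y l} → y ℕ.< F l → l ℕ.≤ m → ∃[ k ] (k ℕ.< l × F k ≡ y × F (suc k) ≡ suc y)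
  crossing {y} {zero} y<F0 _ = ⊥-elim (ℕP.n≮0 (subst (y ℕ.<_) start y<F0))
  crossing {y} {suc l} y<Fl+1 l<m with y <? F l
  ... | yes y<Fl = let (k , k<l , rest) = crossing y<Fl (ℕP.<⇒≤ l<m) in k , ℕP.m≤n⇒m≤1+n k<l , rest
  ... | no y≮Fl with step l l<m
  ...   | inj₁ stay = ⊥-elim (y≮Fl (subst (y ℕ.<_) stay y<Fl+1))
  ...   | inj₂ up   = l , ℕP.≤-refl , Fl≡y , trans up (cong suc Fl≡y)
    where
    Fl≡y : F l ≡ y
    Fl≡y = ℕP.≤-antisym (ℕP.≮⇒≥ y≮Fl) (ℕP.m<1+n⇒m≤n (subst (y ℕ.<_) up y<Fl+1))

  hits : ∀ {y} → y ℕ.≤ n → ∃[ k ] (k ℕ.≤ m × F k ≡ y)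
  hits {y} y≤n with ℕP.m≤n⇒m<n∨m≡n y≤n
  ... | inj₂ refl = m , ℕP.≤-refl , end
  ... | inj₁ y<n  = let (k , k<m , Fk≡y , _) = crossing (subst (y ℕ.<_) (sym end) y<n) ℕP.≤-refl
                    in k , ℕP.<⇒≤ k<m , Fk≡y

clamp : ∀ d → ℕ → Fin (suc d)
clamp d i = fromℕ< (s≤s (ℕP.m⊓n≤n i d))

toℕ-clamp : ∀ {d i} → i ℕ.≤ d → toℕ (clamp d i) ≡ i
toℕ-clamp {d} {i} i≤d = trans (FP.toℕ-fromℕ< (s≤s (ℕP.m⊓n≤n i d))) (ℕP.m≤n⇒m⊓n≡m i≤d)

module FromStepMap {m n : ℕ} (f : Fin (suc m) → Fin (suc n)) (F : ℕ → ℕ)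
                   (on-positions : ∀ x → toℕ (f x) ≡ F (toℕ x)) (s : IsStepMap m n F) where
  open StepMap s

  f-clamp : ∀ {k y} → k ℕ.≤ m → F k ≡ toℕ y → f (clamp m k) ≡ y
  f-clamp k≤m Fk≡y = FP.toℕ-injective (trans (on-positions _) (trans (cong F (toℕ-clamp k≤m)) Fk≡y))

  f-onto : ∀ y → ∃[ x ] f x ≡ y
  f-onto y = let (k , k≤m , Fk≡y) = hits (FP.toℕ≤pred[n] y) in clamp m k , f-clamp k≤m Fk≡y

  f-mono : ∀ {a b} → toℕ a ℕ.≤ toℕ b → toℕ (f a) ℕ.≤ toℕ (f b)
  f-mono {a} {b} a≤b =
    subst₂ ℕ._≤_ (sym (on-positions a)) (sym (on-positions b)) (monotone a≤b (FP.toℕ≤pred[n] b))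

  f-step : ∀ {a b} → suc (toℕ a) ≡ toℕ b → PathR (f a) (f b)
  f-step {a} {b} a+1≡b
    with step (toℕ a) (subst (ℕ._≤ m) (sym a+1≡b) (FP.toℕ≤pred[n] b))
       | trans (cong F a+1≡b) (sym (on-positions b))
  ... | inj₁ stay | F[a+1]≡fb = inj₁ (FP.toℕ-injective (trans (on-positions a) (trans (sym stay) F[a+1]≡fb)))
  ... | inj₂ up   | F[a+1]≡fb = inj₂ (inj₁ (trans (cong suc (on-positions a)) (trans (sym up) F[a+1]≡fb)))

  f-preserves-R : ∀ {a b} → PathR a b → PathR (f a) (f b)
  f-preserves-R (inj₁ refl)      = inj₁ refl
  f-preserves-R (inj₂ (inj₁ up)) = f-step up
  f-preserves-R (inj₂ (inj₂ dn)) = PathR-sym (f-step dn)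

  adjacent-lift : ∀ {x y} → suc (toℕ x) ≡ toℕ y →
                  ∃[ a ] ∃[ b ] (f a ≡ x × f b ≡ y × suc (toℕ a) ≡ toℕ b)
  adjacent-lift {x} {y} x+1≡y with crossing x<Fm ℕP.≤-refl
    where
    x<Fm : toℕ x ℕ.< F m
    x<Fm = subst (toℕ x ℕ.<_) (sym end) (subst (ℕ._≤ n) (sym x+1≡y) (FP.toℕ≤pred[n] y))
  ... | k , k<m , Fk≡x , Fk+1≡x+1 =
    clamp m k , clamp m (suc k) , f-clamp (ℕP.<⇒≤ k<m) Fk≡x , f-clamp k<m (trans Fk+1≡x+1 x+1≡y)
    , trans (cong suc (toℕ-clamp (ℕP.<⇒≤ k<m))) (sym (toℕ-clamp k<m))

  R-image : ∀ x y → PathR x y ⇔ Image (Path m) (Path n) f PathR x y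
  R-image x y = mk⇔ lift (λ { (a , b , refl , refl , r) → f-preserves-R r })
    where
    lift : PathR x y → Image (Path m) (Path n) f PathR x y
    lift (inj₁ refl) = let (a , fa≡x) = f-onto x in a , a , fa≡x , fa≡x , inj₁ refl
    lift (inj₂ (inj₁ up)) = let (a , b , fa , fb , adj) = adjacent-lift up in a , b , fa , fb , inj₂ (inj₁ adj)
    lift (inj₂ (inj₂ dn)) = let (a , b , fa , fb , adj) = adjacent-lift dn in b , a , fb , fa , inj₂ (inj₂ adj)

  Le-image : ∀ x y → x Fin.≤ y ⇔ Image (Path m) (Path n) f Fin._≤_ x y
  Le-image x y = mk⇔ lift (λ { (a , b , refl , refl , a≤b) → f-mono a≤b })
    where
    -- Choose any preimages; if they are in the wrong order, x and y coincide.
    lift : x Fin.≤ y → Image (Path m) (Path n) f Fin._≤_ x y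
    lift x≤y with f-onto x | f-onto y
    ... | a , refl | b , refl with toℕ a ℕ.≤? toℕ b
    ...   | yes a≤b = a , b , refl , refl , a≤b
    ...   | no a≰b  = a , a , refl , FP.toℕ-injective (ℕP.≤-antisym x≤y (f-mono (ℕP.<⇒≤ (ℕP.≰⇒> a≰b)))) , ℕP.≤-refl

  isEpi : IsEpi (Path m) (Path n) f
  isEpi = f-onto , R-image , Le-image

stepEpi : ∀ {m n F} → IsStepMap m n F → Epi (Path m) (Path n)
stepEpi {m} {n} {F} s = epi (λ x → clamp n (F (toℕ x)))
  (FromStepMap.isEpi _ F (λ x → toℕ-clamp (StepMap.bounded s (FP.toℕ≤pred[n] x))) s)

module ToStepMap {d c : ℕ} (φ : Epi (Path d) (Path c)) where
  open Epi φ

  Φ : ℕ → ℕ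
  Φ i = toℕ (map (clamp d i))

  Φ-mono : ∀ {i j} → i ℕ.≤ j → j ℕ.≤ d → Φ i ℕ.≤ Φ j
  Φ-mono {i} {j} i≤j j≤d = preserves-Le φ (subst₂ ℕ._≤_ (sym (toℕ-clamp (ℕP.≤-trans i≤j j≤d))) (sym (toℕ-clamp j≤d)) i≤j)

  Φ-start : Φ 0 ≡ 0
  Φ-start with proj₁ isEpi Fin.zero
  ... | x , x↦0 = ℕP.n≤0⇒n≡0 (subst (Φ 0 ℕ.≤_) (cong toℕ x↦0) (preserves-Le φ 0≤x))
    where
    0≤x : clamp d 0 Fin.≤ x
    0≤x = subst (ℕ._≤ toℕ x) (sym (toℕ-clamp {d} z≤n)) z≤n

  Φ-end : Φ d ≡ c
  Φ-end with proj₁ isEpi (fromℕ c)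
  ... | x , x↦c = ℕP.≤-antisym (FP.toℕ≤pred[n] (map (clamp d d)))
                    (subst (ℕ._≤ Φ d) (trans (cong toℕ x↦c) (FP.toℕ-fromℕ c)) (preserves-Le φ x≤d))
    where
    x≤d : x Fin.≤ clamp d d
    x≤d = subst (toℕ x ℕ.≤_) (sym (toℕ-clamp ℕP.≤-refl)) (FP.toℕ≤pred[n] x)

  -- Adjacent points go to related points, and the order forbids going down.
  Φ-step : ∀ i → i ℕ.< d → Advance (Φ i) (Φ (suc i))
  Φ-step i i<d with preserves-R φ {clamp d i} {clamp d (suc i)} (inj₂ (inj₁ adjacent))
    where
    adjacent : suc (toℕ (clamp d i)) ≡ toℕ (clamp d (suc i))
    adjacent = trans (cong suc (toℕ-clamp (ℕP.<⇒≤ i<d))) (sym (toℕ-clamp i<d))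
  ... | inj₁ same        = inj₁ (cong toℕ (sym same))
  ... | inj₂ (inj₁ up)   = inj₂ (sym up)
  ... | inj₂ (inj₂ down) = ⊥-elim (ℕP.<⇒≱ (ℕP.≤-reflexive down) (Φ-mono (ℕP.n≤1+n i) i<d))

  isStepMap : IsStepMap d c Φ
  isStepMap = record { start = Φ-start ; end = Φ-end ; step = Φ-step }

sum-squeeze : ∀ {i j d e} → i ℕ.≤ d → j ℕ.≤ e → d + e ℕ.≤ i + j → i ≡ d × j ≡ e
sum-squeeze {i} {j} {d} {e} i≤d j≤e full =
    ℕP.≤-antisym i≤d (ℕP.+-cancelʳ-≤ e d i (ℕP.≤-trans full (ℕP.+-monoʳ-≤ i j≤e)))
  , ℕP.≤-antisym j≤e (ℕP.+-cancelˡ-≤ d e j (ℕP.≤-trans full (ℕP.+-monoˡ-≤ j i≤d)))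

module Amalgamation {d e c : ℕ} {Φ₁ Φ₂ : ℕ → ℕ} (s₁ : IsStepMap d c Φ₁) (s₂ : IsStepMap e c Φ₂) where
  private
    module S₁ = StepMap s₁
    module S₂ = StepMap s₂

  record Pos : Set where
    constructor pos
    field
      i     : ℕ
      j     : ℕ
      i≤d   : i ℕ.≤ d
      j≤e   : j ℕ.≤ e
      agree : Φ₁ i ≡ Φ₂ j
  open Pos

  AtEnd : Pos → Set
  AtEnd p = i p ≡ d × j p ≡ e

  record Move (p q : Pos) : Set where
    constructor move
    field
      move₁    : Advance (i p) (i q)
      move₂    : Advance (j p) (j q)
      progress : AtEnd q ⊎ i p + j p ℕ.< i q + j q

  at-bound : ∀ {k m} → k ℕ.≤ m → ¬ (k ℕ.< m) → k ≡ m
  at-bound k≤m k≮m = ℕP.≤-antisym k≤m (ℕP.≮⇒≥ k≮m)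

  advance₁ : ∀ p → i p ℕ.< d → Φ₁ (suc (i p)) ≡ Φ₁ (i p) → Σ Pos (Move p)
  advance₁ (pos i j _ j≤e agree) i<d stay =
    pos (suc i) j i<d j≤e (trans stay agree) , move (inj₂ refl) (inj₁ refl) (inj₂ ℕP.≤-refl)

  advance₂ : ∀ p → j p ℕ.< e → Φ₂ (suc (j p)) ≡ Φ₂ (j p) → Σ Pos (Move p)
  advance₂ (pos i j i≤d _ agree) j<e stay =
    pos i (suc j) i≤d j<e (trans agree (sym stay)) , move (inj₁ refl) (inj₂ refl) (inj₂ (ℕP.+-monoʳ-< i (ℕP.n<1+n j)))

  advance-both : ∀ p → i p ℕ.< d → j p ℕ.< e →
                 Φ₁ (suc (i p)) ≡ suc (Φ₁ (i p)) → Φ₂ (suc (j p)) ≡ suc (Φ₂ (j p)) → Σ Pos (Move p)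
  advance-both (pos i j _ _ agree) i<d j<e up₁ up₂ =
    pos (suc i) (suc j) i<d j<e (trans up₁ (trans (cong suc agree) (sym up₂)))
    , move (inj₂ refl) (inj₂ refl) (inj₂ (ℕP.m≤n⇒m≤1+n (ℕP.+-monoʳ-< i (ℕP.n<1+n j))))

  -- From any position other than the end some coordinate can move; a coordinate that
  -- has reached its end forces the other map to be at the top, where it stays.
  next : (p : Pos) → Σ Pos (Move p)
  next p with i p <? d | j p <? e
  ... | no i≮d | no j≮e = p , move (inj₁ refl) (inj₁ refl) (inj₁ (at-bound (i≤d p) i≮d , at-bound (j≤e p) j≮e))
  ... | yes i<d | no j≮e =
    advance₁ p i<d (S₁.top-stays i<d (trans (agree p) (trans (cong Φ₂ (at-bound (j≤e p) j≮e)) S₂.end)))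
  ... | no i≮d | yes j<e =
    advance₂ p j<e (S₂.top-stays j<e (trans (sym (agree p)) (trans (cong Φ₁ (at-bound (i≤d p) i≮d)) S₁.end)))
  ... | yes i<d | yes j<e with S₁.step (i p) i<d | S₂.step (j p) j<e
  ...   | inj₁ stay₁ | _          = advance₁ p i<d stay₁
  ...   | inj₂ _     | inj₁ stay₂ = advance₂ p j<e stay₂
  ...   | inj₂ up₁   | inj₂ up₂   = advance-both p i<d j<e up₁ up₂

  walk : ℕ → Pos
  walk zero    = pos 0 0 z≤n z≤n (trans S₁.start (sym S₂.start))
  walk (suc k) = proj₁ (next (walk k))

  walk-moves : ∀ k → Move (walk k) (walk (suc k))
  walk-moves k = proj₂ (next (walk k))

  walk-progress : ∀ k → k ℕ.≤ i (walk k) + j (walk k) ⊎ AtEnd (walk k)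
  walk-progress zero = inj₁ z≤n
  walk-progress (suc k) with Move.progress (walk-moves k) | walk-progress k
  ... | inj₁ ended | _         = inj₂ ended
  ... | inj₂ grew  | inj₁ k≤   = inj₁ (ℕP.≤-trans (s≤s k≤) grew)
  ... | inj₂ grew  | inj₂ (i≡d , j≡e) =
    ⊥-elim (ℕP.<⇒≱ grew (subst (i q + j q ℕ.≤_) (sym (cong₂ _+_ i≡d j≡e)) (ℕP.+-mono-≤ (i≤d q) (j≤e q))))
    where
    q : Pos
    q = walk (suc k)

  walk-ends : AtEnd (walk (d + e))
  walk-ends with walk-progress (d + e)
  ... | inj₂ ended = ended
  ... | inj₁ full  = sum-squeeze (i≤d (walk (d + e))) (j≤e (walk (d + e))) full

  walk₁ : IsStepMap (d + e) d (i ∘ walk)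
  walk₁ = record { start = refl ; end = proj₁ walk-ends ; step = λ k _ → Move.move₁ (walk-moves k) }

  walk₂ : IsStepMap (d + e) e (j ∘ walk)
  walk₂ = record { start = refl ; end = proj₂ walk-ends ; step = λ k _ → Move.move₂ (walk-moves k) }

Commutes : ∀ {C D E F} → Epi D C → Epi E C → Epi F D → Epi F E → Set
Commutes {F = F} φ₁ φ₂ ψ₁ ψ₂ = ∀ (x : Carrier F) → Epi.map φ₁ (Epi.map ψ₁ x) ≡ Epi.map φ₂ (Epi.map ψ₂ x)

pathAP : ∀ {c d e} (φ₁ : Epi (Path d) (Path c)) (φ₂ : Epi (Path e) (Path c)) →
         ∃[ m ] Σ (Epi (Path m) (Path d)) λ ψ₁ → Σ (Epi (Path m) (Path e)) λ ψ₂ → Commutes φ₁ φ₂ ψ₁ ψ₂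
pathAP {c} {d} {e} φ₁ φ₂ =
  d + e , stepEpi walk₁ , stepEpi walk₂ , λ x → FP.toℕ-injective (Pos.agree (walk (toℕ x)))
  where
  open Amalgamation (ToStepMap.isStepMap φ₁) (ToStepMap.isStepMap φ₂)

onPaths : ∀ {A B} → InX A → InX B → Epi A B → Epi (Path (Str.size A)) (Path (Str.size B))
onPaths xA xB φ = compEpi (fromPath-epi xA) (compEpi φ (toPath-epi xB))

-- Amalgamate on the paths, then transport back along the isomorphisms; the square
-- in C commutes because the isomorphism C → Path c is injective.
ap : AP InX
ap C D E xC xD xE φ₁ φ₂ = transport (pathAP (onPaths xD xC φ₁) (onPaths xE xC φ₂))
  where
  transport : ∃[ m ] Σ (Epi (Path m) (Path _)) (λ ψ₁ → Σ (Epi (Path m) (Path _)) λ ψ₂ →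
                Commutes (onPaths xD xC φ₁) (onPaths xE xC φ₂) ψ₁ ψ₂) →
              ∃[ F ] (InX F × Σ (Epi F D) λ ψ₁ → Σ (Epi F E) λ ψ₂ → Commutes φ₁ φ₂ ψ₁ ψ₂)
  transport (m , ψ₁ , ψ₂ , commutes) =
    Path m , Path-InX m , compEpi ψ₁ (fromPath-epi xD) , compEpi ψ₂ (fromPath-epi xE) ,
    λ x → to-injective (Ranking.toPath xC) (commutes x)

collapse : ∀ {A} → InX A → Epi A (Path 0)
collapse xA = compEpi (toPath-epi xA) (stepEpi constant)
  where
  constant : IsStepMap _ 0 (λ _ → 0)
  constant = record { start = refl ; end = refl ; step = λ _ _ → inj₁ refl }

jpp : JPP InX
jpp D E xD xE = forget-square (ap (Path 0) D E (Path-InX 0) xD xE (collapse xD) (collapse xE))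
  where
  forget-square : ∃[ F ] (InX F × Σ (Epi F D) λ ψ₁ → Σ (Epi F E) λ ψ₂ → Commutes (collapse xD) (collapse xE) ψ₁ ψ₂) →
                  ∃[ F ] (InX F × Epi F D × Epi F E)
  forget-square (F , xF , ψ₁ , ψ₂ , _) = F , xF , ψ₁ , ψ₂

lemma5p2 : IsProjectiveFraisseFamily InX
lemma5p2 = jpp , ap
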